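{- Let $D$ be an extensional K-model, $M$ a term and $Q$ a test of $\Lambda_{\tau(D)}$, $\vec x=x_1,\dots,x_n$ containing their free variables and $\vec a\in\mathcal A_f(D)^n$. Then $(\vec a,\alpha)\in[\![M]\!]^{\vec x}$ iff the judgment $x_1:a_1,\dots,x_n:a_n\vdash M:\alpha$ is derivable, and $\vec a\in[\![Q]\!]^{\vec x}$ iff $x_1:a_1,\dots,x_n:a_n\vdash Q$ is derivable, in the type system below.
   Context: $D$ is an extensional K-model: a poset with an order isomorphism $i_D:\mathcal A_f(D)^{op}\times D\to D$, where $\mathcal A_f(D)$ is the set of finite antichains ordered by $a\le b$ iff $\forall\alpha\in a\,\exists\beta\in b,\alpha\le\beta$; write $a\to\alpha:=i_D(a,\alpha)$. $\Lambda_{\tau(D)}$: terms $M::=x\mid\lambda x.M\mid MN\mid\sum_{i\le n}\bar\tau_{\alpha_i}(Q_i)$ and tests $Q::=\sum_{i\le n}Q_i\mid\prod_{i\le n}Q_i\mid\tau_\alpha(M)$ ($\alpha,\alpha_i\in D$, $n\ge0$; sums and products are finite multisets). Interpretation ($\vec a\in\mathcal A_f(D)^n$): $[\![x_i]\!]^{\vec x}=\{(\vec a,\alpha)\mid\exists\beta\in a_i,\alpha\le\beta\}$; $[\![\lambda y.M]\!]^{\vec x}=\{(\vec a,b\to\alpha)\mid(\vec ab,\alpha)\in[\![M]\!]^{\vec xy}\}$; $[\![MN]\!]^{\vec x}=\{(\vec a,\alpha)\mid\exists b,(\vec a,b\to\alpha)\in[\![M]\!]^{\vec x}\wedge\forall\beta\in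 b,(\vec a,\beta)\in[\![N]\!]^{\vec x}\}$; $[\![\sum_{i}\bar\tau_{\alpha_i}(Q_i)]\!]^{\vec x}=\bigcup_i\{(\vec a,\beta)\mid\vec a\in[\![Q_i]\!]^{\vec x},\beta\le\alpha_i\}$; $[\![\tau_\alpha(M)]\!]^{\vec x}=\{\vec a\mid(\vec a,\alpha)\in[\![M]\!]^{\vec x}\}$; $[\![\prod_iQ_i]\!]^{\vec x}=\bigcap_i[\![Q_i]\!]^{\vec x}$ (empty product: $\mathcal A_f(D)^n$); $[\![\sum_iQ_i]\!]^{\vec x}=\bigcup_i[\![Q_i]\!]^{\vec x}$. Type system ($\Gamma$ an environment of declarations $x:a$): $x:a\vdash x:\alpha$ if $\alpha\in a$; from $\Gamma\vdash M:\alpha$ infer $\Gamma,x:a\vdash M:\alpha$; from $\Gamma\vdash M:\beta$ and $\alpha\le\beta$ infer $\Gamma\vdash M:\alpha$; from $\Gamma,x:a\vdash M:\alpha$ infer $\Gamma\vdash\lambda x.M:a\to\alpha$; from $\Gamma\vdash M:a\to\alpha$ and $\Gamma\vdash N:\beta$ for all $\beta\in a$ infer $\Gamma\vdash MN:\alpha$; from $\Gamma\vdash Q_i$ for some $i\le n$ infer $\Gamma\vdash\sum_{i\le n}\bar\tau_{\alpha_i}(Q_i):\alpha_i$; from $\Gamma\vdash M:\alpha$ infer $\Gamma\vdash\tau_\alpha(M)$; from $\Gamma\vdash Q_i$ for some $i\le n$ infer $\Gamma\vdash\sum_{i\le n}Q_i$; from $\Gamma\vdash Q_i$ for all $i\le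 n$ infer $\Gamma\vdash\prod_{i\le n}Q_i$. -}

module Defs where

open import Level using (Level; _⊔_; suc; Lift)
open import Data.Nat using (ℕ) renaming (suc to sucℕ)
open import Data.Fin using (Fin; zero)
open import Data.Vec using (Vec; []; _∷_; lookup; replicate; _[_]≔_) renaming (map to vmap)
open import Data.List using (List)
open import Data.List.Relation.Unary.All using (All)
open import Data.List.Relation.Unary.Any using (Any)
open import Data.List.Relation.Unary.AllPairs using (AllPairs)
open import Data.List.Membership.Propositional using (_∈_)
open import Data.Maybe using (Maybe; just; nothing)
open import Data.Product using (Σ; Σ-syntax; _×_; _,_)
open import Data.Sum using (_⊎_)
open import Data.Empty.Polymorphic using (⊥)
open import Data.Unit.Polymorphic using (⊤)
open import Relation.Nullary using (¬_)
open import Relation.Binary.Bundles using (Poset)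
open import Relation.Binary.PropositionalEquality using (_≡_)
open import Function.Bundles using (_⇔_)

module _ {c ℓ₁ ℓ₂} (P : Poset c ℓ₁ ℓ₂) where
  open Poset P

  -- a finite antichain, represented by a list of pairwise incomparable
  -- elements (a finite antichain is determined up to ≤A-equivalence)
  record Antichain : Set (c ⊔ ℓ₂) where
    constructor antichain
    field
      elems : List Carrier
      anti  : AllPairs (λ x y → ¬ (x ≤ y) × ¬ (y ≤ x)) elems
  open Antichain public

  _≤A_ : Antichain → Antichain → Set (c ⊔ ℓ₂)
  a ≤A b = All (λ α → Any (λ β → α ≤ β) (elems b)) (elems a)

-- Extensional K-models: a poset D with an order isomorphism
-- i_D : A_f(D)^op × D → D, written  a ⇒ α

record KModel c ℓ₁ ℓ₂ : Set (suc (c ⊔ ℓ₁ ⊔ ℓ₂)) where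
  field
    poset : Poset c ℓ₁ ℓ₂
  open Poset poset public
  AF : Set (c ⊔ ℓ₂)
  AF = Antichain poset
  field
    _⇒_     : AF → Carrier → Carrier
    ⇒-order : ∀ a α b β → ((a ⇒ α) ≤ (b ⇒ β)) ⇔ (_≤A_ poset b a × α ≤ β)
    -- surjective (injectivity up to equality follows from order reflection)
    ⇒-surj  : ∀ γ → Σ[ a ∈ AF ] Σ[ α ∈ Carrier ] γ ≈ (a ⇒ α)

-- The calculus Λ_τ(D), its interpretation and its type system.
-- Scoped de Bruijn syntax: Term n has free variables among x_1..x_n
-- (Fin n); a λ binds variable  zero  and shifts the others.

module Model {c ℓ₁ ℓ₂} (D : KModel c ℓ₁ ℓ₂) where
  open KModel D

  mutual
    data Term (n : ℕ) : Set c where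
      var  : Fin n → Term n
      lam  : Term (sucℕ n) → Term n
      app  : Term n → Term n → Term n
      -- Σ_i τ̄_{α_i}(Q_i)   (finite multiset as a list)
      tsum : List (Carrier × Test n) → Term n

    data Test (n : ℕ) : Set c where
      qsum  : List (Test n) → Test n
      qprod : List (Test n) → Test n
      tau   : Carrier → Term n → Test n

  Env : ℕ → Set (c ⊔ ℓ₂)
  Env n = Vec AF n

  -- Interpretation:  ⟦ M ⟧ a⃗ α  means  (a⃗ , α) ∈ [[M]]^x⃗ ;
  --                  ⟦ Q ⟧Q a⃗    means  a⃗ ∈ [[Q]]^x⃗
  mutual
    ⟦_⟧ : ∀ {n} → Term n → Env n → Carrier → Set (c ⊔ ℓ₁ ⊔ ℓ₂)
    ⟦ var i ⟧ as α   = Lift ℓ₁ (Any (λ β → α ≤ β) (elems (lookup as i)))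
    ⟦ lam M ⟧ as γ   = Σ[ b ∈ AF ] Σ[ α ∈ Carrier ] (γ ≈ (b ⇒ α) × ⟦ M ⟧ (b ∷ as) α)
    ⟦ app M N ⟧ as α = Σ[ b ∈ AF ] (⟦ M ⟧ as (b ⇒ α) × All (λ β → ⟦ N ⟧ as β) (elems b))
    ⟦ tsum xs ⟧ as β = ⟦ xs ⟧Σ as β

    ⟦_⟧Σ : ∀ {n} → List (Carrier × Test n) → Env n → Carrier → Set (c ⊔ ℓ₁ ⊔ ℓ₂)
    ⟦ List.[] ⟧Σ as β             = ⊥
    ⟦ (α , Q) List.∷ xs ⟧Σ as β   = (⟦ Q ⟧Q as × β ≤ α) ⊎ ⟦ xs ⟧Σ as β

    ⟦_⟧Q : ∀ {n} → Test n → Env n → Set (c ⊔ ℓ₁ ⊔ ℓ₂)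
    ⟦ qsum Qs ⟧Q as  = ⟦ Qs ⟧∪ as
    ⟦ qprod Qs ⟧Q as = ⟦ Qs ⟧∩ as
    ⟦ tau α M ⟧Q as  = ⟦ M ⟧ as α

    ⟦_⟧∪ : ∀ {n} → List (Test n) → Env n → Set (c ⊔ ℓ₁ ⊔ ℓ₂)
    ⟦ List.[] ⟧∪ as     = ⊥
    ⟦ Q List.∷ Qs ⟧∪ as = ⟦ Q ⟧Q as ⊎ ⟦ Qs ⟧∪ as

    ⟦_⟧∩ : ∀ {n} → List (Test n) → Env n → Set (c ⊔ ℓ₁ ⊔ ℓ₂)
    ⟦ List.[] ⟧∩ as     = ⊤
    ⟦ Q List.∷ Qs ⟧∩ as = ⟦ Q ⟧Q as × ⟦ Qs ⟧∩ as

  -- Type environments: partial maps from the variables in scope to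
  -- antichains (nothing = variable not declared).
  PEnv : ℕ → Set (c ⊔ ℓ₂)
  PEnv n = Vec (Maybe AF) n

  single : ∀ {n} → Fin n → AF → PEnv n
  single {n} i a = replicate n nothing [ i ]≔ just a

  full : ∀ {n} → Env n → PEnv n
  full as = vmap just as

  infix 4 _⊢_∶_ _⊢Q_
  mutual
    data _⊢_∶_ {n : ℕ} : PEnv n → Term n → Carrier → Set (c ⊔ ℓ₁ ⊔ ℓ₂) where
      ax   : ∀ {i a α} → α ∈ elems a → single i a ⊢ var i ∶ α
      weak : ∀ {Γ M α x a} → Γ ⊢ M ∶ α → lookup Γ x ≡ nothing →
             (Γ [ x ]≔ just a) ⊢ M ∶ α
      sub  : ∀ {Γ M α β} → Γ ⊢ M ∶ β → α ≤ β → Γ ⊢ M ∶ α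
      abs  : ∀ {Γ M a α} → (just a ∷ Γ) ⊢ M ∶ α → Γ ⊢ lam M ∶ (a ⇒ α)
      appl : ∀ {Γ M N a α} → Γ ⊢ M ∶ (a ⇒ α) →
             (∀ {β} → β ∈ elems a → Γ ⊢ N ∶ β) → Γ ⊢ app M N ∶ α
      sumτ : ∀ {Γ xs α Q} → (α , Q) ∈ xs → Γ ⊢Q Q → Γ ⊢ tsum xs ∶ α

    data _⊢Q_ {n : ℕ} : PEnv n → Test n → Set (c ⊔ ℓ₁ ⊔ ℓ₂) where
      τ    : ∀ {Γ M α} → Γ ⊢ M ∶ α → Γ ⊢Q tau α M
      sumQ : ∀ {Γ Qs Q} → Q ∈ Qs → Γ ⊢Q Q → Γ ⊢Q qsum Qs
      prod : ∀ {Γ Qs} → (∀ {Q} → Q ∈ Qs → Γ ⊢Q Q) → Γ ⊢Q qprod Qs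

-- Soundness goes by induction on derivations: the interpretation is monotone in the
-- environment (handling the axiom and weakening) and downward closed in the type
-- (handling subsumption); downward closure at a λ-abstraction is where the model must
-- be extensional, since an arbitrary element below  b ⇒ α  has to be of the form
-- b′ ⇒ α′. Completeness goes by induction on the term: each clause of the
-- interpretation is matched by one typing rule, the only mismatch being that the
-- axiom types a variable in the singleton environment, which weakening extends to
-- the full one.
module Submission where

open import Defs
open import Level using (_⊔_; lift)
open import Data.Nat using (ℕ)
open import Data.Fin using (Fin; zero; suc; _≟_)
open import Data.Vec using (_∷_; lookup; replicate; _[_]≔_)
open import Data.Vec.Properties using (lookup∘update; lookup∘update′; lookup-replicate; lookup-map)
open import Data.Vec.Relation.Binary.Pointwise.Inductive as Pointwise
  using (Pointwise; _∷_; Pointwise-≡⇒≡)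
open import Data.Vec.Relation.Binary.Pointwise.Extensional using (ext; extensional⇒inductive)
open import Data.List using (List; []; _∷_; allFin)
open import Data.List.Relation.Unary.All as All using (All; _∷_)
open import Data.List.Relation.Unary.Any as Any using (Any; here; there)
open import Data.List.Membership.Propositional using (_∈_; find)
open import Data.List.Membership.Propositional.Properties using (∈-allFin)
open import Data.Maybe using (just; nothing)
open import Data.Product using (Σ-syntax; _×_; _,_)
open import Data.Sum as Sum using (_⊎_; inj₁; inj₂)
open import Data.Unit.Polymorphic using (tt)
open import Data.Empty using (⊥-elim)
open import Relation.Nullary using (yes; no)
open import Relation.Binary.Bundles using (Poset)
open import Relation.Binary.PropositionalEquality using (_≡_; _≢_; refl; sym; trans; subst)
open import Function.Base using (_∘_)
open import Function.Bundles using (_⇔_; mk⇔; Equivalence)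

module _ {c ℓ₁ ℓ₂} (P : Poset c ℓ₁ ℓ₂) where
  open Poset P using (Carrier; _≤_) renaming (refl to ≤-refl; trans to ≤-trans)

  ≤A-refl : ∀ a → _≤A_ P a a
  ≤A-refl a = All.tabulate (Any.map (λ { refl → ≤-refl }))

  Any≤-≤A-trans : ∀ {α} {xs ys : List Carrier} → Any (α ≤_) xs →
                  All (λ β → Any (β ≤_) ys) xs → Any (α ≤_) ys
  Any≤-≤A-trans (here α≤β) (β≤ys ∷ _) = Any.map (≤-trans α≤β) β≤ys
  Any≤-≤A-trans (there α≤xs) (_ ∷ xs≤ys) = Any≤-≤A-trans α≤xs xs≤ys

module Properties {c ℓ₁ ℓ₂} (D : KModel c ℓ₁ ℓ₂) where
  open KModel D renaming (refl to ≤-refl; trans to ≤-trans)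
  open Model D

  _≤E_ : ∀ {n} → Env n → Env n → Set (c ⊔ ℓ₂)
  _≤E_ = Pointwise (_≤A_ poset)

  ≤E-refl : ∀ {n} {as : Env n} → as ≤E as
  ≤E-refl = Pointwise.refl λ {a} → ≤A-refl poset a

  mutual
    ⟦⟧-mono : ∀ {n} (M : Term n) {as bs} → as ≤E bs → ∀ {α} → ⟦ M ⟧ as α → ⟦ M ⟧ bs α
    ⟦⟧-mono (var i) as≤bs (lift α≤a) = lift (Any≤-≤A-trans poset α≤a (Pointwise.lookup as≤bs i))
    ⟦⟧-mono (lam M) as≤bs (b , α , γ≈b⇒α , m) =
      b , α , γ≈b⇒α , ⟦⟧-mono M (≤A-refl poset b ∷ as≤bs) m
    ⟦⟧-mono (app M N) as≤bs (b , m , ns) = b , ⟦⟧-mono M as≤bs m , All.map (⟦⟧-mono N as≤bs) ns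
    ⟦⟧-mono (tsum xs) as≤bs s = ⟦⟧Σ-mono xs as≤bs s

    ⟦⟧Σ-mono : ∀ {n} (xs : List (Carrier × Test n)) {as bs} → as ≤E bs →
               ∀ {β} → ⟦ xs ⟧Σ as β → ⟦ xs ⟧Σ bs β
    ⟦⟧Σ-mono ((α , Q) ∷ xs) as≤bs (inj₁ (q , β≤α)) = inj₁ (⟦⟧Q-mono Q as≤bs q , β≤α)
    ⟦⟧Σ-mono ((α , Q) ∷ xs) as≤bs (inj₂ s) = inj₂ (⟦⟧Σ-mono xs as≤bs s)

    ⟦⟧Q-mono : ∀ {n} (Q : Test n) {as bs} → as ≤E bs → ⟦ Q ⟧Q as → ⟦ Q ⟧Q bs
    ⟦⟧Q-mono (qsum Qs) as≤bs q = ⟦⟧∪-mono Qs as≤bs q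
    ⟦⟧Q-mono (qprod Qs) as≤bs q = ⟦⟧∩-mono Qs as≤bs q
    ⟦⟧Q-mono (tau α M) as≤bs q = ⟦⟧-mono M as≤bs q

    ⟦⟧∪-mono : ∀ {n} (Qs : List (Test n)) {as bs} → as ≤E bs → ⟦ Qs ⟧∪ as → ⟦ Qs ⟧∪ bs
    ⟦⟧∪-mono (Q ∷ Qs) as≤bs (inj₁ q) = inj₁ (⟦⟧Q-mono Q as≤bs q)
    ⟦⟧∪-mono (Q ∷ Qs) as≤bs (inj₂ q) = inj₂ (⟦⟧∪-mono Qs as≤bs q)

    ⟦⟧∩-mono : ∀ {n} (Qs : List (Test n)) {as bs} → as ≤E bs → ⟦ Qs ⟧∩ as → ⟦ Qs ⟧∩ bs
    ⟦⟧∩-mono [] as≤bs _ = tt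
    ⟦⟧∩-mono (Q ∷ Qs) as≤bs (q , qs) = ⟦⟧Q-mono Q as≤bs q , ⟦⟧∩-mono Qs as≤bs qs

  ⟦⟧Σ-↓ : ∀ {n} (xs : List (Carrier × Test n)) {as α β} → β ≤ α → ⟦ xs ⟧Σ as α → ⟦ xs ⟧Σ as β
  ⟦⟧Σ-↓ ((α , Q) ∷ xs) β≤α (inj₁ (q , α≤α′)) = inj₁ (q , ≤-trans β≤α α≤α′)
  ⟦⟧Σ-↓ ((α , Q) ∷ xs) β≤α (inj₂ s) = inj₂ (⟦⟧Σ-↓ xs β≤α s)

  ⟦⟧-↓ : ∀ {n} (M : Term n) {as α β} → β ≤ α → ⟦ M ⟧ as α → ⟦ M ⟧ as β
  ⟦⟧-↓ (var i) β≤α (lift α≤a) = lift (Any.map (≤-trans β≤α) α≤a)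
  ⟦⟧-↓ (lam M) {α = γ} {γ′} γ′≤γ (b , α , γ≈b⇒α , m) =
    let b′ , α′ , γ′≈b′⇒α′ = ⇒-surj γ′
        b≤b′ , α′≤α = Equivalence.to (⇒-order b′ α′ b α)
          (≤-trans (reflexive (Eq.sym γ′≈b′⇒α′)) (≤-trans γ′≤γ (reflexive γ≈b⇒α)))
    in b′ , α′ , γ′≈b′⇒α′ , ⟦⟧-↓ M α′≤α (⟦⟧-mono M (b≤b′ ∷ ≤E-refl) m)
  ⟦⟧-↓ (app M N) {α = α} β≤α (b , m , ns) =
    b , ⟦⟧-↓ M (Equivalence.from (⇒-order b _ b α) (≤A-refl poset b , β≤α)) m , ns
  ⟦⟧-↓ (tsum xs) β≤α s = ⟦⟧Σ-↓ xs β≤α s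

  AgreeExcept : ∀ {n} → PEnv n → PEnv n → List (Fin n) → Set (c ⊔ ℓ₂)
  AgreeExcept Γ Δ js = ∀ j → lookup Γ j ≡ lookup Δ j ⊎ (lookup Γ j ≡ nothing × j ∈ js)

  AgreeExcept-discharge : ∀ {n} {Γ Δ : PEnv n} {k js} → lookup Γ k ≡ lookup Δ k →
                          AgreeExcept Γ Δ (k ∷ js) → AgreeExcept Γ Δ js
  AgreeExcept-discharge Γk≡Δk agree j with agree j
  ... | inj₁ Γj≡Δj = inj₁ Γj≡Δj
  ... | inj₂ (_ , here refl) = inj₁ Γk≡Δk
  ... | inj₂ (Γj≡nothing , there j∈js) = inj₂ (Γj≡nothing , j∈js)

  AgreeExcept-fill : ∀ {n} {Γ Δ : PEnv n} {k js a} → lookup Δ k ≡ just a →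
                     AgreeExcept Γ Δ (k ∷ js) → AgreeExcept (Γ [ k ]≔ just a) Δ js
  AgreeExcept-fill {Γ = Γ} {k = k} Δk≡a agree j with j ≟ k
  ... | yes refl = inj₁ (trans (lookup∘update k Γ _) (sym Δk≡a))
  ... | no j≢k with agree j
  ...   | inj₁ Γj≡Δj = inj₁ (trans (lookup∘update′ j≢k Γ _) Γj≡Δj)
  ...   | inj₂ (_ , here refl) = ⊥-elim (j≢k refl)
  ...   | inj₂ (Γj≡nothing , there j∈js) = inj₂ (trans (lookup∘update′ j≢k Γ _) Γj≡nothing , j∈js)

  -- The weakening rule declares one undeclared variable at a time, so the pending
  -- positions js serve as the induction measure.
  weaken-pending : ∀ {n} {Γ Δ : PEnv n} js {M α} → AgreeExcept Γ Δ js → Γ ⊢ M ∶ α → Δ ⊢ M ∶ α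
  weaken-pending {Γ = Γ} {Δ} [] {M} {α} agree d =
    subst (_⊢ M ∶ α) (Pointwise-≡⇒≡ (extensional⇒inductive (ext agreed))) d
    where
      agreed : ∀ j → lookup Γ j ≡ lookup Δ j
      agreed j with agree j
      ... | inj₁ Γj≡Δj = Γj≡Δj
  weaken-pending {Γ = Γ} {Δ} (k ∷ js) agree d with agree k
  ... | inj₁ Γk≡Δk = weaken-pending js (AgreeExcept-discharge {Γ = Γ} {Δ} Γk≡Δk agree) d
  ... | inj₂ (Γk≡nothing , _) with lookup Δ k in Δk≡
  ...   | just a = weaken-pending js (AgreeExcept-fill {Γ = Γ} {Δ} Δk≡ agree) (weak d Γk≡nothing)
  ...   | nothing =
    weaken-pending js (AgreeExcept-discharge {Γ = Γ} {Δ} (trans Γk≡nothing (sym Δk≡)) agree) d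

  _⊑_ : ∀ {n} → PEnv n → PEnv n → Set (c ⊔ ℓ₂)
  Γ ⊑ Δ = ∀ j → lookup Γ j ≡ lookup Δ j ⊎ lookup Γ j ≡ nothing

  weakening : ∀ {n} {Γ Δ : PEnv n} {M α} → Γ ⊑ Δ → Γ ⊢ M ∶ α → Δ ⊢ M ∶ α
  weakening Γ⊑Δ = weaken-pending (allFin _) λ j → Sum.map₂ (_, ∈-allFin j) (Γ⊑Δ j)

  single-⊑-full : ∀ {n} (as : Env n) i → single i (lookup as i) ⊑ full as
  single-⊑-full as i j with j ≟ i
  ... | yes refl = inj₁ (trans (lookup∘update i (replicate _ nothing) _) (sym (lookup-map i just as)))
  ... | no j≢i = inj₂ (trans (lookup∘update′ j≢i (replicate _ nothing) _) (lookup-replicate j nothing))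

  _≼_ : ∀ {n} → PEnv n → Env n → Set (c ⊔ ℓ₂)
  Γ ≼ as = ∀ j {a} → lookup Γ j ≡ just a → _≤A_ poset a (lookup as j)

  full-≼ : ∀ {n} (as : Env n) → full as ≼ as
  full-≼ as j fullj≡a with trans (sym (lookup-map j just as)) fullj≡a
  ... | refl = ≤A-refl poset (lookup as j)

  ≼-∷ : ∀ {n} {Γ : PEnv n} {as} a → Γ ≼ as → (just a ∷ Γ) ≼ (a ∷ as)
  ≼-∷ a Γ≼as zero refl = ≤A-refl poset a
  ≼-∷ a Γ≼as (suc j) Γj≡a′ = Γ≼as j Γj≡a′

  ≼-update⁻ : ∀ {n} {Γ : PEnv n} {as x a} → lookup Γ x ≡ nothing →
              (Γ [ x ]≔ just a) ≼ as → Γ ≼ as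
  ≼-update⁻ {Γ = Γ} {x = x} Γx≡nothing Γ′≼as j Γj≡a′ = Γ′≼as j (trans (lookup∘update′ j≢x Γ _) Γj≡a′)
    where
      j≢x : j ≢ x
      j≢x refl with trans (sym Γx≡nothing) Γj≡a′
      ... | ()

  ⟦⟧Σ-∈ : ∀ {n} {xs : List (Carrier × Test n)} {as α Q} → (α , Q) ∈ xs → ⟦ Q ⟧Q as → ⟦ xs ⟧Σ as α
  ⟦⟧Σ-∈ (here refl) q = inj₁ (q , ≤-refl)
  ⟦⟧Σ-∈ (there m) q = inj₂ (⟦⟧Σ-∈ m q)

  ⟦⟧∪-∈ : ∀ {n} {Qs : List (Test n)} {as Q} → Q ∈ Qs → ⟦ Q ⟧Q as → ⟦ Qs ⟧∪ as
  ⟦⟧∪-∈ (here refl) q = inj₁ q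
  ⟦⟧∪-∈ (there m) q = inj₂ (⟦⟧∪-∈ m q)

  ⟦⟧∩-∀∈ : ∀ {n} (Qs : List (Test n)) {as} → (∀ {Q} → Q ∈ Qs → ⟦ Q ⟧Q as) → ⟦ Qs ⟧∩ as
  ⟦⟧∩-∀∈ [] q = tt
  ⟦⟧∩-∀∈ (Q ∷ Qs) q = q (here refl) , ⟦⟧∩-∀∈ Qs (q ∘ there)

  mutual
    sound : ∀ {n} {Γ : PEnv n} {M α} → Γ ⊢ M ∶ α → ∀ {as} → Γ ≼ as → ⟦ M ⟧ as α
    sound (ax {i} α∈a) Γ≼as = lift (All.lookup (Γ≼as i (lookup∘update i (replicate _ nothing) _)) α∈a)
    sound (weak {Γ} {x = x} {a} d Γx≡nothing) {as} Γ≼as =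
      sound d (≼-update⁻ {Γ = Γ} {as} {x} {a} Γx≡nothing Γ≼as)
    sound (sub {M = M} d α≤β) Γ≼as = ⟦⟧-↓ M α≤β (sound d Γ≼as)
    sound (abs {a = a} {α} d) Γ≼as = a , α , Eq.refl , sound d (≼-∷ a Γ≼as)
    sound (appl {a = a} d ds) Γ≼as = a , sound d Γ≼as , All.tabulate λ β∈a → sound (ds β∈a) Γ≼as
    sound (sumτ m q) Γ≼as = ⟦⟧Σ-∈ m (soundQ q Γ≼as)

    soundQ : ∀ {n} {Γ : PEnv n} {Q} → Γ ⊢Q Q → ∀ {as} → Γ ≼ as → ⟦ Q ⟧Q as
    soundQ (τ d) Γ≼as = sound d Γ≼as
    soundQ (sumQ m q) Γ≼as = ⟦⟧∪-∈ m (soundQ q Γ≼as)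
    soundQ (prod qs) Γ≼as = ⟦⟧∩-∀∈ _ λ m → soundQ (qs m) Γ≼as

  mutual
    complete : ∀ {n} (M : Term n) (as : Env n) {α} → ⟦ M ⟧ as α → full as ⊢ M ∶ α
    complete (var i) as (lift α≤a) =
      let β , β∈a , α≤β = find α≤a
      in sub (weakening (single-⊑-full as i) (ax β∈a)) α≤β
    complete (lam M) as (b , α , γ≈b⇒α , m) = sub (abs (complete M (b ∷ as) m)) (reflexive γ≈b⇒α)
    complete (app M N) as (b , m , ns) = appl (complete M as m) λ β∈b → complete N as (All.lookup ns β∈b)
    complete (tsum xs) as s =
      let α , Q , m , q , β≤α = completeΣ xs as s
      in sub (sumτ m q) β≤α

    completeΣ : ∀ {n} (xs : List (Carrier × Test n)) (as : Env n) {β} → ⟦ xs ⟧Σ as β →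
                Σ[ α ∈ Carrier ] Σ[ Q ∈ Test n ] ((α , Q) ∈ xs × full as ⊢Q Q × β ≤ α)
    completeΣ ((α , Q) ∷ xs) as (inj₁ (q , β≤α)) = α , Q , here refl , completeQ Q as q , β≤α
    completeΣ ((α , Q) ∷ xs) as (inj₂ s) =
      let α′ , Q′ , m , q , β≤α′ = completeΣ xs as s
      in α′ , Q′ , there m , q , β≤α′

    completeQ : ∀ {n} (Q : Test n) (as : Env n) → ⟦ Q ⟧Q as → full as ⊢Q Q
    completeQ (qsum Qs) as q = let Q , m , q′ = complete∪ Qs as q in sumQ m q′
    completeQ (qprod Qs) as q = prod (complete∩ Qs as q)
    completeQ (tau α M) as q = τ (complete M as q)

    complete∪ : ∀ {n} (Qs : List (Test n)) (as : Env n) → ⟦ Qs ⟧∪ as →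
                Σ[ Q ∈ Test n ] (Q ∈ Qs × full as ⊢Q Q)
    complete∪ (Q ∷ Qs) as (inj₁ q) = Q , here refl , completeQ Q as q
    complete∪ (Q ∷ Qs) as (inj₂ q) = let Q′ , m , q′ = complete∪ Qs as q in Q′ , there m , q′

    complete∩ : ∀ {n} (Qs : List (Test n)) (as : Env n) → ⟦ Qs ⟧∩ as → ∀ {Q} → Q ∈ Qs → full as ⊢Q Q
    complete∩ (Q ∷ Qs) as (q , _) (here refl) = completeQ Q as q
    complete∩ (Q ∷ Qs) as (_ , qs) (there m) = complete∩ Qs as qs m

mainTheorem2 : ∀ {c ℓ₁ ℓ₂} (D : KModel c ℓ₁ ℓ₂) →
    (∀ (n : ℕ) (M : Model.Term D n) (as : Model.Env D n) (α : KModel.Carrier D) →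
       Model.⟦_⟧ D M as α ⇔ Model._⊢_∶_ D (Model.full D as) M α)
    ×
    (∀ (n : ℕ) (Q : Model.Test D n) (as : Model.Env D n) →
       Model.⟦_⟧Q D Q as ⇔ Model._⊢Q_ D (Model.full D as) Q)
mainTheorem2 D =
  (λ n M as α → mk⇔ (complete M as) (λ d → sound d (full-≼ as))) ,
  (λ n Q as → mk⇔ (completeQ Q as) (λ d → soundQ d (full-≼ as)))
  where open Properties D
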